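{- Let $\mathbb{F}_q$ be a finite field with $q$ elements, let $\ell$ be a prime with $\gcd(\ell,q)=1$, let $s=\nu_\ell(q-1)\ge 1$ be the exponent of the largest power of $\ell$ dividing $q-1$, and assume $s\neq 1$ if $\ell=2$. Fix a primitive $\ell^s$-th root of unity $\mu_s\in\mathbb{F}_q^*$ and put $\mu_j=\mu_s^{\ell^{s-j}}$ for $0\le j\le s$. Let $n\ge 1$, $1\le k\le s$, and $r=\min\{n,s-k\}$. Let $C_k$ be the $\mu_k$-constacyclic code of length $\ell^n$ over $\mathbb{F}_q$ with parity check polynomial $x^{\ell^{n-r}}-\mu_{k+r}$. Then the generator polynomial of $C_k$ is $$g_k(x)=\sum_{i=0}^{\ell^r-1}\mu_{k+r}^{\,i}\,x^{\ell^{n-r}(\ell^r-i-1)},$$ and $$C_k=\left\{(\mathbf{a},\,\mathbf{a}\mu_{k+r},\,\mathbf{a}\mu_{k+r}^2,\,\dots,\,\mathbf{a}\mu_{k+r}^{\ell^r-1}) : \mathbf{a}\in\mathbb{F}_q^{\ell^{n-r}}\right\},$$ where for $\mathbf{a}=(a_0,\dots,a_{\ell^{n-r}-1})$ and $\theta\in\mathbb{F}_q$ we write $\mathbf{a}\theta=(a_0\theta,\dots,a_{\ell^{n-r}-1}\theta)$, and the tuple denotes the concatenation of these $\ell^r$ blocks into a vector of length $\ell^n$.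
   Context: For $\mu\in\mathbb{F}_q^*$ and $m\ge 1$, a linear code $C\subseteq\mathbb{F}_q^m$ is $\mu$-constacyclic if $(c_1,\dots,c_{m-1},\mu c_0)\in C$ whenever $(c_0,\dots,c_{m-1})\in C$. A vector $(a_0,\dots,a_{m-1})$ is identified with the polynomial $a_0x^{m-1}+a_1x^{m-2}+\cdots+a_{m-1}$ modulo $x^m-\mu$; with $\gcd(m,q)=1$, $\mu$-constacyclic codes are the ideals $\langle g(x)\rangle$ of $\mathbb{F}_q[x]/\langle x^m-\mu\rangle$ with $g$ a monic divisor of $x^m-\mu$ (the generator polynomial), and $(x^m-\mu)/g(x)$ is the parity check polynomial. Codewords of $C_k$ are the vectors corresponding to the polynomials $\mathbf{a}(x)g_k(x)$ where $\mathbf{a}(x)=\sum_{j=0}^{\ell^{n-r}-1}a_jx^{\ell^{n-r}-j-1}$. -}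

module Defs where

open import Level using (Level; _⊔_)
open import Algebra.Bundles using (CommutativeRing)
open import Data.Nat as ℕ using (ℕ; zero; suc; _∸_)
open import Data.Fin as Fin using (Fin; toℕ)
open import Data.List as List using (List; []; _∷_; replicate; reverse; upTo; foldr)
open import Data.Vec as Vec using (Vec)
open import Data.Product using (Σ; ∃; _×_)
open import Relation.Nullary using (¬_)
open import Relation.Binary.PropositionalEquality using (_≡_)

-- Everything is parametrised by a commutative ring whose carrier will be
-- required to be a finite field (with setoid equality _≈_).
module FieldDefs {c ℓ : Level} (R : CommutativeRing c ℓ) where
  open CommutativeRing R renaming (Carrier to F)

  IsField : Set (c ⊔ ℓ)
  IsField = (¬ (1# ≈ 0#)) × (∀ x → ¬ (x ≈ 0#) → ∃ λ y → x * y ≈ 1#)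

  HasSize : ℕ → Set (c ⊔ ℓ)
  HasSize q = Σ (Fin q → F) λ e →
                (∀ x → ∃ λ i → e i ≈ x) × (∀ i j → e i ≈ e j → i ≡ j)

  pow : F → ℕ → F
  pow x zero    = 1#
  pow x (suc n) = x * pow x n

  IsPrimitiveRoot : ℕ → F → Set ℓ
  IsPrimitiveRoot N x = (pow x N ≈ 1#) × (∀ d → 0 ℕ.< d → d ℕ.< N → ¬ (pow x d ≈ 1#))

  -- Polynomials: coefficient lists, lowest degree first.
  Poly : Set c
  Poly = List F

  coeff : Poly → ℕ → F
  coeff []       _       = 0#
  coeff (a ∷ p)  zero    = a
  coeff (a ∷ p)  (suc i) = coeff p i

  _≈ₚ_ : Poly → Poly → Set ℓ
  p ≈ₚ q = ∀ i → coeff p i ≈ coeff q i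

  _+ₚ_ : Poly → Poly → Poly
  []      +ₚ q       = q
  (a ∷ p) +ₚ []      = a ∷ p
  (a ∷ p) +ₚ (b ∷ q) = (a + b) ∷ (p +ₚ q)

  -ₚ_ : Poly → Poly
  -ₚ p = List.map -_ p

  _-ₚ_ : Poly → Poly → Poly
  p -ₚ q = p +ₚ (-ₚ q)

  scale : F → Poly → Poly
  scale a p = List.map (a *_) p

  _*ₚ_ : Poly → Poly → Poly
  []      *ₚ q = []
  (a ∷ p) *ₚ q = scale a q +ₚ (0# ∷ (p *ₚ q))

  mono : F → ℕ → Poly
  mono a d = replicate d 0# List.++ (a ∷ [])

  binom : ℕ → F → Poly
  binom m μ = mono 1# m -ₚ mono μ 0

  -- Codewords. A vector (a_0,…,a_{m-1}) is identified with the polynomial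
  -- a_0 x^{m-1} + a_1 x^{m-2} + … + a_{m-1}.
  vecPoly : ∀ {m} → Vec F m → Poly
  vecPoly v = reverse (Vec.toList v)

  _≡_mod_ : Poly → Poly → Poly → Set (c ⊔ ℓ)
  f ≡ g mod d = ∃ λ t → (f -ₚ g) ≈ₚ (t *ₚ d)

  IsGenPolyFor : ℕ → F → Poly → Poly → Set ℓ
  IsGenPolyFor m μ h g = (g *ₚ h) ≈ₚ binom m μ

  -- c belongs to the ideal ⟨g⟩ of F[x]/⟨x^m − μ⟩
  InIdeal : (m : ℕ) → F → Poly → Vec F m → Set (c ⊔ ℓ)
  InIdeal m μ g v = ∃ λ f → vecPoly v ≡ (f *ₚ g) mod binom m μ

  InCodeWithParityCheck : (m : ℕ) → F → Poly → Vec F m → Set (c ⊔ ℓ)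
  InCodeWithParityCheck m μ h v = ∃ λ g → IsGenPolyFor m μ h g × InIdeal m μ g v

  -- entry of a vector at a natural-number index (0 outside the range)
  at : ∀ {m} → Vec F m → ℕ → F
  at {zero}  _             _       = 0#
  at {suc m} (x Vec.∷ v)   zero    = x
  at {suc m} (x Vec.∷ v)   (suc i) = at v i

  -- v is the concatenation (a, aθ, aθ², …, aθ^{B-1}) of B blocks of length L:
  -- position j·L + t (j < B, t < L) holds a_t θ^j
  IsBlockVector : ∀ {m} (L B : ℕ) → Vec F m → Vec F L → F → Set ℓ
  IsBlockVector L B v a θ =
    ∀ j (t : Fin L) → j ℕ.< B → at v (j ℕ.* L ℕ.+ toℕ t) ≈ Vec.lookup a t * pow θ j

  sumₚ : List Poly → Poly
  sumₚ = foldr _+ₚ_ []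

  gk : (L B : ℕ) → F → Poly
  gk L B θ = sumₚ (List.map (λ i → mono (pow θ i) (L ℕ.* (B ∸ i ∸ 1))) (upTo B))

module Submission where

-- Put θ = μ_{k+r}, L = ℓ^{n-r} and B = ℓ^r, so that the length is
-- ℓ^n = L·B and μ_k = θ^B.  The rest holds in any commutative
-- ring and is proved there (module Constacyclic):
--  * g_B = Σ_{i<B} θ^i x^{L(B-1-i)} satisfies g_{B+1} = x^{LB} + θ·g_B, so
--    the coefficients of φ·g_B obey a recursion (mulGk) that telescopes:
--    φ·g_B·(x^L − θ) = φ·(x^{LB} − θ^B).
--  * x^L − θ cancels from products since its constant term is a unit, so
--    g_B is the only g with g·(x^L − θ) = x^{LB} − θ^B.
--  * A word v lies in the code iff its polynomial is φ·g_B for some φ.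
--    Such a φ has degree < L, because φ_d = θ^B φ_{LB+d} for d ≥ L and φ
--    has finite support; and for φ of degree < L the coefficients of φ·g_B
--    are the blocks a, aθ, …, aθ^{B-1}, read backwards.
-- Polynomials are compared through their coefficient sequences ℕ → F, on
-- which the shift operator sh (multiplication by x^d) is the basic tool.

open import Defs
open import Algebra.Bundles using (CommutativeRing)
open import Data.Nat using (ℕ; suc; _+_; _∸_; _^_; _≤_; _⊓_)
open import Data.Nat.Divisibility using (_∣_)
open import Data.Nat.Primality using (Prime)
open import Data.Nat.Coprimality using (Coprime)
open import Data.Vec using (Vec)
open import Data.Product using (∃; _×_)
open import Function.Bundles using (_⇔_)
open import Relation.Nullary using (¬_)
open import Relation.Binary.PropositionalEquality using (_≡_; _≢_)

open import Data.Nat as ℕ using (zero; _<_; _*_; s≤s; NonZero)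
import Data.Nat.Properties as ℕₚ
open import Data.Nat.DivMod using (_/_; _%_; m≡m%n+[m/n]*n; m%n<n; m<n*o⇒m/o<n)
open import Data.Nat.Induction using (<-rec)
open import Data.Nat.Primality using (prime⇒nonZero)
open import Data.Nat.Tactic.RingSolver using (solve-∀)
open import Data.List as List using ([]; _∷_; _++_; length; reverse; upTo; applyUpTo)
import Data.List.Properties as Listₚ
import Data.Vec as Vec
import Data.Vec.Properties as Vecₚ
open import Data.Fin as Fin using (Fin; toℕ)
import Data.Fin.Properties as Finₚ
open import Data.Product using (_,_; proj₁)
open import Data.Sum using (inj₁; inj₂)
open import Function.Bundles using (mk⇔)
open import Relation.Nullary using (yes; no)
import Relation.Binary.PropositionalEquality as P

-- Arithmetic of positions in a vector made of B blocks of length L.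
module BlockIndex where
  open P.≡-Reasoning

  reflect-< : ∀ B j → j < B → B ∸ suc j < B
  reflect-< (suc B) j _ = s≤s (ℕₚ.m∸n≤m B j)

  reflect-involutive : ∀ B j → j < B → B ∸ suc (B ∸ suc j) ≡ j
  reflect-involutive B j j<B =
    P.subst (λ X → X ∸ suc (B ∸ suc j) ≡ j) (ℕₚ.m+[n∸m]≡n j<B) (ℕₚ.m+n∸n≡m j (B ∸ suc j))

  block-< : ∀ L B j t → j < B → t < L → L * j + t < L * B
  block-< L B j t j<B t<L = ℕₚ.<-≤-trans (ℕₚ.+-monoʳ-< (L * j) t<L)
    (P.subst (_≤ L * B) (P.trans (ℕₚ.*-suc L j) (ℕₚ.+-comm L (L * j))) (ℕₚ.*-monoʳ-≤ L j<B))

  reflect-block : ∀ L B j t → j < B → t < L →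
                  L * B ∸ suc (j * L + t) ≡ L * (B ∸ suc j) + (L ∸ suc t)
  reflect-block L B j t j<B t<L =
    P.trans (P.cong (_∸ suc (j * L + t)) split) (ℕₚ.m+n∸n≡m _ (suc (j * L + t)))
    where
    b = B ∸ suc j
    u = L ∸ suc t
    split : L * B ≡ (L * b + u) + suc (j * L + t)
    split = begin
      L * B                     ≡⟨ P.cong (L *_) (P.sym (ℕₚ.m+[n∸m]≡n j<B)) ⟩
      L * (suc j + b)           ≡⟨ ℕₚ.*-distribˡ-+ L (suc j) b ⟩
      L * suc j + L * b         ≡⟨ P.cong (λ X → X * suc j + L * b) (P.sym (ℕₚ.m+[n∸m]≡n t<L)) ⟩
      (suc t + u) * suc j + L * b ≡⟨ rearrange t u j (L * b) ⟩
      (L * b + u) + suc (j * (suc t + u) + t) ≡⟨ P.cong (λ X → (L * b + u) + suc (j * X + t)) (ℕₚ.m+[n∸m]≡n t<L) ⟩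
      (L * b + u) + suc (j * L + t) ∎
      where
      rearrange : ∀ t u j Y → (suc t + u) * suc j + Y ≡ (Y + u) + suc (j * (suc t + u) + t)
      rearrange = solve-∀

  reflected-block-decomposition : ∀ L B .{{_ : NonZero L}} e → e < L * B →
    ∃ λ j → ∃ λ (t : Fin L) → j < B × e ≡ L * (B ∸ suc j) + (L ∸ suc (toℕ t))
  reflected-block-decomposition L B e e<LB = j , t , j<B , (begin
    e                                         ≡⟨ reflect-involutive (L * B) e e<LB ⟨
    L * B ∸ suc i                             ≡⟨ P.cong (λ x → L * B ∸ suc x) i≡ ⟩
    L * B ∸ suc (j * L + toℕ t)               ≡⟨ reflect-block L B j (toℕ t) j<B (Finₚ.toℕ<n t) ⟩
    L * (B ∸ suc j) + (L ∸ suc (toℕ t))       ∎)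
    where
    i = L * B ∸ suc e
    j = i / L
    t : Fin L
    t = Fin.fromℕ< (m%n<n i L)
    j<B : j < B
    j<B = m<n*o⇒m/o<n (P.subst (i <_) (ℕₚ.*-comm L B) (reflect-< (L * B) e e<LB))
    i≡ : i ≡ j * L + toℕ t
    i≡ = P.trans (m≡m%n+[m/n]*n i L)
                 (P.trans (ℕₚ.+-comm (i % L) (j * L)) (P.cong (j * L +_) (P.sym (Finₚ.toℕ-fromℕ< (m%n<n i L)))))

open BlockIndex

-- Words and their polynomials.  The polynomial of a word (a_0, …, a_{m−1})
-- is a_0 x^{m−1} + … + a_{m−1}: position i is the coefficient of x^{m−1−i}.
module Words {c ℓ} (R : CommutativeRing c ℓ) where
  open CommutativeRing R using (0#) renaming (Carrier to F)
  open FieldDefs R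
  open P.≡-Reasoning

  coeff-beyond : ∀ xs i → length xs ≤ i → coeff xs i ≡ 0#
  coeff-beyond []       i       _          = P.refl
  coeff-beyond (x ∷ xs) (suc i) (s≤s len≤) = coeff-beyond xs i len≤

  at-toList : ∀ {m} (v : Vec F m) i → at v i ≡ coeff (Vec.toList v) i
  at-toList Vec.[]       i       = P.refl
  at-toList (x Vec.∷ v) zero    = P.refl
  at-toList (x Vec.∷ v) (suc i) = at-toList v i

  lookup-at : ∀ {m} (v : Vec F m) (t : Fin m) → Vec.lookup v t ≡ at v (toℕ t)
  lookup-at (x Vec.∷ v) Fin.zero    = P.refl
  lookup-at (x Vec.∷ v) (Fin.suc t) = lookup-at v t

  coeff-++ˡ : ∀ ys zs i → i < length ys → coeff (ys ++ zs) i ≡ coeff ys i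
  coeff-++ˡ (y ∷ ys) zs zero    _         = P.refl
  coeff-++ˡ (y ∷ ys) zs (suc i) (s≤s i<n) = coeff-++ˡ ys zs i i<n

  coeff-++ʳ : ∀ ys zs i → coeff (ys ++ zs) (length ys + i) ≡ coeff zs i
  coeff-++ʳ []       zs i = P.refl
  coeff-++ʳ (y ∷ ys) zs i = coeff-++ʳ ys zs i

  coeff-reverse : ∀ xs i → i < length xs → coeff (reverse xs) (length xs ∸ suc i) ≡ coeff xs i
  coeff-reverse (x ∷ xs) zero _ = begin
    coeff (reverse (x ∷ xs)) (length xs)            ≡⟨ P.cong (λ q → coeff q (length xs)) (Listₚ.unfold-reverse x xs) ⟩
    coeff (reverse xs ++ x ∷ []) (length xs)        ≡⟨ P.cong (coeff (reverse xs ++ x ∷ [])) length≡ ⟩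
    coeff (reverse xs ++ x ∷ []) (length (reverse xs) + 0) ≡⟨ coeff-++ʳ (reverse xs) (x ∷ []) 0 ⟩
    x                                               ∎
    where
    length≡ : length xs ≡ length (reverse xs) + 0
    length≡ = P.sym (P.trans (ℕₚ.+-identityʳ _) (Listₚ.length-reverse xs))
  coeff-reverse (x ∷ xs) (suc i) (s≤s i<n) = begin
    coeff (reverse (x ∷ xs)) (length xs ∸ suc i)    ≡⟨ P.cong (λ q → coeff q (length xs ∸ suc i)) (Listₚ.unfold-reverse x xs) ⟩
    coeff (reverse xs ++ x ∷ []) (length xs ∸ suc i) ≡⟨ coeff-++ˡ (reverse xs) (x ∷ []) _ in-range ⟩
    coeff (reverse xs) (length xs ∸ suc i)          ≡⟨ coeff-reverse xs i i<n ⟩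
    coeff xs i                                      ∎
    where
    in-range : length xs ∸ suc i < length (reverse xs)
    in-range = P.subst (length xs ∸ suc i <_) (P.sym (Listₚ.length-reverse xs)) (reflect-< (length xs) i i<n)

  length-vecPoly : ∀ {m} (v : Vec F m) → length (vecPoly v) ≡ m
  length-vecPoly v = P.trans (Listₚ.length-reverse (Vec.toList v)) (Vecₚ.length-toList v)

  coeff-vecPoly : ∀ {m} (v : Vec F m) i → i < m → coeff (vecPoly v) (m ∸ suc i) ≡ at v i
  coeff-vecPoly v i i<m =
    P.subst (λ n → coeff (vecPoly v) (n ∸ suc i) ≡ at v i) (Vecₚ.length-toList v)
      (P.trans (coeff-reverse (Vec.toList v) i (P.subst (i <_) (P.sym (Vecₚ.length-toList v)) i<m))
               (P.sym (at-toList v i)))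

  coeff-vecPoly-beyond : ∀ {m} (v : Vec F m) e → m ≤ e → coeff (vecPoly v) e ≡ 0#
  coeff-vecPoly-beyond v e m≤e = coeff-beyond (vecPoly v) e (P.subst (_≤ e) (P.sym (length-vecPoly v)) m≤e)

  coeff-vecPoly-block : ∀ L B (v : Vec F (L * B)) j t → j < B → t < L →
                        coeff (vecPoly v) (L * (B ∸ suc j) + (L ∸ suc t)) ≡ at v (j * L + t)
  coeff-vecPoly-block L B v j t j<B t<L =
    P.subst (λ e → coeff (vecPoly v) e ≡ at v (j * L + t)) (reflect-block L B j t j<B t<L)
      (coeff-vecPoly v (j * L + t) (P.subst (λ x → x + t < L * B) (ℕₚ.*-comm L j) (block-< L B j t j<B t<L)))

-- Polynomials over an arbitrary commutative ring, handled through their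
-- coefficient sequences, and the two descriptions of the code.
module Constacyclic {c ℓ} (R : CommutativeRing c ℓ) where
  open CommutativeRing R hiding (zero) renaming (Carrier to F; _+_ to _⊕_; _*_ to _·_)
  open FieldDefs R
  open Words R
  open import Relation.Binary.Reasoning.Setoid setoid
  open import Algebra.Properties.Ring ring using (-‿distribˡ-*; -‿distribʳ-*; -0#≈0#; -1*x≈-x)
  open import Algebra.Properties.Group +-group using (quasigroup; x∙y⁻¹≈ε⇒x≈y; ⁻¹-involutive)
  open import Algebra.Properties.Quasigroup quasigroup using (cancelˡ)
  open import Algebra.Properties.CommutativeSemigroup +-commutativeSemigroup
    using (interchange) renaming (x∙yz≈y∙xz to ⊕-left-comm)
  open import Algebra.Properties.CommutativeSemigroup *-commutativeSemigroup
    using () renaming (x∙yz≈y∙xz to ·-left-comm)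
  open import Algebra.Properties.Semiring.Exp semiring
    using (^-homo-*; ^-assocʳ) renaming (_^_ to _^ᴿ_)

  unit-cancelˡ : ∀ {θ θ' x y} → θ · θ' ≈ 1# → θ · x ≈ θ · y → x ≈ y
  unit-cancelˡ {θ} {θ'} {x} {y} θθ' θx≈θy = begin
    x             ≈⟨ *-identityˡ x ⟨
    1# · x        ≈⟨ *-congʳ θ'θ ⟨
    (θ' · θ) · x  ≈⟨ *-assoc θ' θ x ⟩
    θ' · (θ · x)  ≈⟨ *-congˡ θx≈θy ⟩
    θ' · (θ · y)  ≈⟨ *-assoc θ' θ y ⟨
    (θ' · θ) · y  ≈⟨ *-congʳ θ'θ ⟩
    1# · y        ≈⟨ *-identityˡ y ⟩
    y             ∎
    where θ'θ = trans (*-comm θ' θ) θθ'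

  -‿unit : ∀ {θ θ'} → θ · θ' ≈ 1# → (- θ) · (- θ') ≈ 1#
  -‿unit {θ} {θ'} θθ' = begin
    (- θ) · (- θ')  ≈⟨ -‿distribˡ-* θ (- θ') ⟨
    - (θ · (- θ'))  ≈⟨ -‿cong (-‿distribʳ-* θ θ') ⟨
    - (- (θ · θ'))  ≈⟨ ⁻¹-involutive _ ⟩
    θ · θ'          ≈⟨ θθ' ⟩
    1#              ∎

  difference-zero : ∀ {a b c} → a ⊕ (- c) · b ≈ 0# → a ≈ c · b
  difference-zero {a} {b} {c} eq = x∙y⁻¹≈ε⇒x≈y a (c · b) (trans (+-congˡ (-‿distribˡ-* c b)) eq)

  move-right : ∀ {p x y} → p ⊕ - x ≈ y → p ≈ x ⊕ y
  move-right {p} {x} {y} eq = begin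
    p               ≈⟨ +-identityʳ p ⟨
    p ⊕ 0#          ≈⟨ +-congˡ (-‿inverseˡ x) ⟨
    p ⊕ (- x ⊕ x)   ≈⟨ +-assoc p (- x) x ⟨
    (p ⊕ - x) ⊕ x   ≈⟨ +-congʳ eq ⟩
    y ⊕ x           ≈⟨ +-comm y x ⟩
    x ⊕ y           ∎

  telescope-step : ∀ X Y Z W P t c → Z ⊕ (- t) · W ≈ Y ⊕ (- c) · P →
                   (X ⊕ t · Z) ⊕ (- t) · (Y ⊕ t · W) ≈ X ⊕ (- (t · c)) · P
  telescope-step X Y Z W P t c eq = begin
    (X ⊕ t · Z) ⊕ (- t) · (Y ⊕ t · W)          ≈⟨ +-assoc X _ _ ⟩
    X ⊕ (t · Z ⊕ (- t) · (Y ⊕ t · W))          ≈⟨ +-congˡ (+-congˡ (distribˡ (- t) Y (t · W))) ⟩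
    X ⊕ (t · Z ⊕ ((- t) · Y ⊕ (- t) · (t · W))) ≈⟨ +-congˡ (⊕-left-comm _ _ _) ⟩
    X ⊕ ((- t) · Y ⊕ (t · Z ⊕ (- t) · (t · W))) ≈⟨ +-congˡ (+-congˡ (+-congˡ (·-left-comm (- t) t W))) ⟩
    X ⊕ ((- t) · Y ⊕ (t · Z ⊕ t · ((- t) · W))) ≈⟨ +-congˡ (+-congˡ (distribˡ t Z _)) ⟨
    X ⊕ ((- t) · Y ⊕ t · (Z ⊕ (- t) · W))       ≈⟨ +-congˡ (+-congˡ (*-congˡ eq)) ⟩
    X ⊕ ((- t) · Y ⊕ t · (Y ⊕ (- c) · P))       ≈⟨ +-congˡ (+-congˡ (distribˡ t Y _)) ⟩
    X ⊕ ((- t) · Y ⊕ (t · Y ⊕ t · ((- c) · P))) ≈⟨ +-congˡ (+-assoc _ _ _) ⟨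
    X ⊕ (((- t) · Y ⊕ t · Y) ⊕ t · ((- c) · P)) ≈⟨ +-congˡ (+-congʳ (distribʳ Y (- t) t)) ⟨
    X ⊕ ((- t ⊕ t) · Y ⊕ t · ((- c) · P))       ≈⟨ +-congˡ (+-congʳ (trans (*-congʳ (-‿inverseˡ t)) (zeroˡ Y))) ⟩
    X ⊕ (0# ⊕ t · ((- c) · P))                  ≈⟨ +-congˡ (+-identityˡ _) ⟩
    X ⊕ t · ((- c) · P)                         ≈⟨ +-congˡ (*-assoc t (- c) P) ⟨
    X ⊕ (t · (- c)) · P                         ≈⟨ +-congˡ (*-congʳ (-‿distribʳ-* t c)) ⟨
    X ⊕ (- (t · c)) · P                         ∎

  -- pow of Defs is the exponentiation of the library, whose laws we reuse.
  pow≡^ : ∀ x n → pow x n ≡ x ^ᴿ n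
  pow≡^ x zero    = P.refl
  pow≡^ x (suc n) = P.cong (x ·_) (pow≡^ x n)

  pow-+ : ∀ x a b → pow x (a + b) ≈ pow x a · pow x b
  pow-+ x a b = begin
    pow x (a + b)           ≡⟨ pow≡^ x (a + b) ⟩
    x ^ᴿ (a + b)            ≈⟨ ^-homo-* x a b ⟩
    x ^ᴿ a · x ^ᴿ b         ≡⟨ P.cong₂ _·_ (pow≡^ x a) (pow≡^ x b) ⟨
    pow x a · pow x b       ∎

  pow-* : ∀ x a b → pow x (a * b) ≈ pow (pow x a) b
  pow-* x a b = begin
    pow x (a * b)           ≡⟨ pow≡^ x (a * b) ⟩
    x ^ᴿ (a * b)            ≈⟨ ^-assocʳ x a b ⟨
    (x ^ᴿ a) ^ᴿ b           ≡⟨ P.cong (_^ᴿ b) (pow≡^ x a) ⟨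
    pow x a ^ᴿ b            ≡⟨ pow≡^ (pow x a) b ⟨
    pow (pow x a) b         ∎

  -- sh d f is the coefficient sequence of x^d · f.
  sh : ℕ → (ℕ → F) → ℕ → F
  sh zero    f e       = f e
  sh (suc d) f zero    = 0#
  sh (suc d) f (suc e) = sh d f e

  sh-cong-below : ∀ {f g} d e → (∀ i → i + d ≤ e → f i ≈ g i) → sh d f e ≈ sh d g e
  sh-cong-below zero    e       f≈g = f≈g e (ℕₚ.≤-reflexive (ℕₚ.+-identityʳ e))
  sh-cong-below (suc d) zero    f≈g = refl
  sh-cong-below (suc d) (suc e) f≈g =
    sh-cong-below d e (λ i i+d≤e → f≈g i (P.subst (_≤ suc e) (P.sym (ℕₚ.+-suc i d)) (s≤s i+d≤e)))

  sh-cong : ∀ {f g} → (∀ i → f i ≈ g i) → ∀ d e → sh d f e ≈ sh d g e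
  sh-cong f≈g d e = sh-cong-below d e (λ i _ → f≈g i)

  sh-+ : ∀ f g d e → sh d (λ i → f i ⊕ g i) e ≈ sh d f e ⊕ sh d g e
  sh-+ f g zero    e       = refl
  sh-+ f g (suc d) zero    = sym (+-identityˡ 0#)
  sh-+ f g (suc d) (suc e) = sh-+ f g d e

  sh-scale : ∀ a f d e → sh d (λ i → a · f i) e ≈ a · sh d f e
  sh-scale a f zero    e       = refl
  sh-scale a f (suc d) zero    = sym (zeroʳ a)
  sh-scale a f (suc d) (suc e) = sh-scale a f d e

  sh-zero : ∀ d e → sh d (λ _ → 0#) e ≈ 0#
  sh-zero zero    e       = refl
  sh-zero (suc d) zero    = refl
  sh-zero (suc d) (suc e) = sh-zero d e

  sh-sh : ∀ f a b e → sh a (sh b f) e ≡ sh (a + b) f e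
  sh-sh f zero    b e       = P.refl
  sh-sh f (suc a) b zero    = P.refl
  sh-sh f (suc a) b (suc e) = sh-sh f a b e

  sh-comm : ∀ f a b e → sh a (sh b f) e ≡ sh b (sh a f) e
  sh-comm f a b e =
    P.trans (sh-sh f a b e) (P.trans (P.cong (λ d → sh d f e) (ℕₚ.+-comm a b)) (P.sym (sh-sh f b a e)))

  sh-+ˡ : ∀ f d e → sh d f (d + e) ≡ f e
  sh-+ˡ f zero    e = P.refl
  sh-+ˡ f (suc d) e = sh-+ˡ f d e

  sh-≥ : ∀ f d e → d ≤ e → sh d f e ≡ f (e ∸ d)
  sh-≥ f d e d≤e = P.trans (P.cong (sh d f) (P.sym (ℕₚ.m+[n∸m]≡n d≤e))) (sh-+ˡ f d (e ∸ d))

  sh-< : ∀ f d e → e < d → sh d f e ≡ 0#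
  sh-< f (suc d) zero    _         = P.refl
  sh-< f (suc d) (suc e) (s≤s e<d) = sh-< f d e e<d

  δ : ℕ → F
  δ = coeff (1# ∷ [])

  coeff-+ₚ : ∀ p q i → coeff (p +ₚ q) i ≈ coeff p i ⊕ coeff q i
  coeff-+ₚ []      q       i       = sym (+-identityˡ _)
  coeff-+ₚ (a ∷ p) []      i       = sym (+-identityʳ _)
  coeff-+ₚ (a ∷ p) (b ∷ q) zero    = refl
  coeff-+ₚ (a ∷ p) (b ∷ q) (suc i) = coeff-+ₚ p q i

  coeff-scale : ∀ a p i → coeff (scale a p) i ≈ a · coeff p i
  coeff-scale a []      i       = sym (zeroʳ a)
  coeff-scale a (b ∷ p) zero    = refl
  coeff-scale a (b ∷ p) (suc i) = coeff-scale a p i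

  coeff--ₚ : ∀ p i → coeff (-ₚ p) i ≈ - coeff p i
  coeff--ₚ []      i       = sym -0#≈0#
  coeff--ₚ (a ∷ p) zero    = refl
  coeff--ₚ (a ∷ p) (suc i) = coeff--ₚ p i

  coeff-mono : ∀ b d e → coeff (mono b d) e ≡ sh d (coeff (b ∷ [])) e
  coeff-mono b zero    e       = P.refl
  coeff-mono b (suc d) zero    = P.refl
  coeff-mono b (suc d) (suc e) = coeff-mono b d e

  mono-scale : ∀ a b d i → coeff (mono (a · b) d) i ≈ coeff (scale a (mono b d)) i
  mono-scale a b zero    zero    = refl
  mono-scale a b zero    (suc i) = refl
  mono-scale a b (suc d) zero    = sym (zeroʳ a)
  mono-scale a b (suc d) (suc i) = mono-scale a b d i

  coeff-binom : ∀ m μ e → coeff (binom m μ) e ≈ sh m δ e ⊕ (- μ) · δ e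
  coeff-binom m μ e = trans (coeff-+ₚ (mono 1# m) (- μ ∷ []) e) (+-cong (reflexive (coeff-mono 1# m e)) (constant e))
    where
    constant : ∀ e → coeff (- μ ∷ []) e ≈ (- μ) · δ e
    constant zero    = sym (*-identityʳ _)
    constant (suc e) = sym (zeroʳ _)

  coeff-*ₚ-∷ : ∀ a p q i → coeff ((a ∷ p) *ₚ q) i ≈ a · coeff q i ⊕ sh 1 (coeff (p *ₚ q)) i
  coeff-*ₚ-∷ a p q zero    = trans (coeff-+ₚ (scale a q) _ zero) (+-congʳ (coeff-scale a q zero))
  coeff-*ₚ-∷ a p q (suc i) = trans (coeff-+ₚ (scale a q) _ (suc i)) (+-congʳ (coeff-scale a q (suc i)))

  *ₚ-[]ʳ : ∀ p i → coeff (p *ₚ []) i ≈ 0#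
  *ₚ-[]ʳ []      i = refl
  *ₚ-[]ʳ (a ∷ p) i = begin
    coeff ((a ∷ p) *ₚ []) i        ≈⟨ coeff-*ₚ-∷ a p [] i ⟩
    a · 0# ⊕ sh 1 (coeff (p *ₚ [])) i ≈⟨ +-cong (zeroʳ a) (trans (sh-cong (*ₚ-[]ʳ p) 1 i) (sh-zero 1 i)) ⟩
    0# ⊕ 0#                        ≈⟨ +-identityˡ 0# ⟩
    0#                             ∎

  *ₚ-distribˡ : ∀ p q r i → coeff (p *ₚ (q +ₚ r)) i ≈ coeff (p *ₚ q) i ⊕ coeff (p *ₚ r) i
  *ₚ-distribˡ []      q r i = sym (+-identityˡ 0#)
  *ₚ-distribˡ (a ∷ p) q r i = begin
    coeff ((a ∷ p) *ₚ (q +ₚ r)) i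
      ≈⟨ coeff-*ₚ-∷ a p (q +ₚ r) i ⟩
    a · coeff (q +ₚ r) i ⊕ sh 1 (coeff (p *ₚ (q +ₚ r))) i
      ≈⟨ +-cong (*-congˡ (coeff-+ₚ q r i)) (sh-cong (*ₚ-distribˡ p q r) 1 i) ⟩
    a · (coeff q i ⊕ coeff r i) ⊕ sh 1 (λ j → coeff (p *ₚ q) j ⊕ coeff (p *ₚ r) j) i
      ≈⟨ +-cong (distribˡ a _ _) (sh-+ _ _ 1 i) ⟩
    (a · coeff q i ⊕ a · coeff r i) ⊕ (sh 1 (coeff (p *ₚ q)) i ⊕ sh 1 (coeff (p *ₚ r)) i)
      ≈⟨ interchange _ _ _ _ ⟩
    (a · coeff q i ⊕ sh 1 (coeff (p *ₚ q)) i) ⊕ (a · coeff r i ⊕ sh 1 (coeff (p *ₚ r)) i)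
      ≈⟨ +-cong (coeff-*ₚ-∷ a p q i) (coeff-*ₚ-∷ a p r i) ⟨
    coeff ((a ∷ p) *ₚ q) i ⊕ coeff ((a ∷ p) *ₚ r) i
      ∎

  *ₚ-scaleʳ : ∀ p b q i → coeff (p *ₚ scale b q) i ≈ b · coeff (p *ₚ q) i
  *ₚ-scaleʳ []      b q i = sym (zeroʳ b)
  *ₚ-scaleʳ (a ∷ p) b q i = begin
    coeff ((a ∷ p) *ₚ scale b q) i
      ≈⟨ coeff-*ₚ-∷ a p (scale b q) i ⟩
    a · coeff (scale b q) i ⊕ sh 1 (coeff (p *ₚ scale b q)) i
      ≈⟨ +-cong (*-congˡ (coeff-scale b q i)) (sh-cong (*ₚ-scaleʳ p b q) 1 i) ⟩
    a · (b · coeff q i) ⊕ sh 1 (λ j → b · coeff (p *ₚ q) j) i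
      ≈⟨ +-cong (·-left-comm a b _) (sh-scale b _ 1 i) ⟩
    b · (a · coeff q i) ⊕ b · sh 1 (coeff (p *ₚ q)) i
      ≈⟨ distribˡ b _ _ ⟨
    b · (a · coeff q i ⊕ sh 1 (coeff (p *ₚ q)) i)
      ≈⟨ *-congˡ (coeff-*ₚ-∷ a p q i) ⟨
    b · coeff ((a ∷ p) *ₚ q) i
      ∎

  *ₚ-congʳ : ∀ {q r} → q ≈ₚ r → ∀ p → (p *ₚ q) ≈ₚ (p *ₚ r)
  *ₚ-congʳ q≈r []      i = refl
  *ₚ-congʳ {q} {r} q≈r (a ∷ p) i = begin
    coeff ((a ∷ p) *ₚ q) i                    ≈⟨ coeff-*ₚ-∷ a p q i ⟩
    a · coeff q i ⊕ sh 1 (coeff (p *ₚ q)) i   ≈⟨ +-cong (*-congˡ (q≈r i)) (sh-cong (*ₚ-congʳ q≈r p) 1 i) ⟩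
    a · coeff r i ⊕ sh 1 (coeff (p *ₚ r)) i   ≈⟨ coeff-*ₚ-∷ a p r i ⟨
    coeff ((a ∷ p) *ₚ r) i                    ∎

  *ₚ-constʳ : ∀ p b i → coeff (p *ₚ (b ∷ [])) i ≈ b · coeff p i
  *ₚ-constʳ []      b i       = sym (zeroʳ b)
  *ₚ-constʳ (a ∷ p) b zero    = trans (coeff-*ₚ-∷ a p (b ∷ []) zero) (trans (+-identityʳ _) (*-comm a b))
  *ₚ-constʳ (a ∷ p) b (suc i) = begin
    coeff ((a ∷ p) *ₚ (b ∷ [])) (suc i)   ≈⟨ coeff-*ₚ-∷ a p (b ∷ []) (suc i) ⟩
    a · 0# ⊕ coeff (p *ₚ (b ∷ [])) i      ≈⟨ +-cong (zeroʳ a) (*ₚ-constʳ p b i) ⟩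
    0# ⊕ b · coeff p i                    ≈⟨ +-identityˡ _ ⟩
    b · coeff p i                         ∎

  *ₚ-shiftʳ : ∀ p q i → coeff (p *ₚ (0# ∷ q)) i ≈ sh 1 (coeff (p *ₚ q)) i
  *ₚ-shiftʳ []      q i       = sym (sh-zero 1 i)
  *ₚ-shiftʳ (a ∷ p) q zero    = trans (coeff-*ₚ-∷ a p (0# ∷ q) zero) (trans (+-identityʳ _) (zeroʳ a))
  *ₚ-shiftʳ (a ∷ p) q (suc i) = begin
    coeff ((a ∷ p) *ₚ (0# ∷ q)) (suc i)   ≈⟨ coeff-*ₚ-∷ a p (0# ∷ q) (suc i) ⟩
    a · coeff q i ⊕ coeff (p *ₚ (0# ∷ q)) i ≈⟨ +-congˡ (*ₚ-shiftʳ p q i) ⟩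
    a · coeff q i ⊕ sh 1 (coeff (p *ₚ q)) i ≈⟨ coeff-*ₚ-∷ a p q i ⟨
    coeff ((a ∷ p) *ₚ q) i                ∎

  *ₚ-monoʳ : ∀ p b d e → coeff (p *ₚ mono b d) e ≈ sh d (λ i → b · coeff p i) e
  *ₚ-monoʳ p b zero    e = *ₚ-constʳ p b e
  *ₚ-monoʳ p b (suc d) e = begin
    coeff (p *ₚ (0# ∷ mono b d)) e        ≈⟨ *ₚ-shiftʳ p (mono b d) e ⟩
    sh 1 (coeff (p *ₚ mono b d)) e        ≈⟨ sh-cong (*ₚ-monoʳ p b d) 1 e ⟩
    sh 1 (sh d (λ i → b · coeff p i)) e   ≡⟨ sh-sh _ 1 d e ⟩
    sh (suc d) (λ i → b · coeff p i) e    ∎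

  *ₚ-binomʳ : ∀ p m μ e → coeff (p *ₚ binom m μ) e ≈ sh m (coeff p) e ⊕ (- μ) · coeff p e
  *ₚ-binomʳ p m μ e = begin
    coeff (p *ₚ binom m μ) e                                ≈⟨ *ₚ-distribˡ p (mono 1# m) (- μ ∷ []) e ⟩
    coeff (p *ₚ mono 1# m) e ⊕ coeff (p *ₚ (- μ ∷ [])) e    ≈⟨ +-cong (*ₚ-monoʳ p 1# m e) (*ₚ-constʳ p (- μ) e) ⟩
    sh m (λ i → 1# · coeff p i) e ⊕ (- μ) · coeff p e       ≈⟨ +-congʳ (sh-cong (λ i → *-identityˡ _) m e) ⟩
    sh m (coeff p) e ⊕ (- μ) · coeff p e                    ∎

  *ₚ-binom-congˡ : ∀ p q m μ → p ≈ₚ q → (p *ₚ binom m μ) ≈ₚ (q *ₚ binom m μ)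
  *ₚ-binom-congˡ p q m μ p≈q e = begin
    coeff (p *ₚ binom m μ) e                ≈⟨ *ₚ-binomʳ p m μ e ⟩
    sh m (coeff p) e ⊕ (- μ) · coeff p e    ≈⟨ +-cong (sh-cong p≈q m e) (*-congˡ (p≈q e)) ⟩
    sh m (coeff q) e ⊕ (- μ) · coeff q e    ≈⟨ *ₚ-binomʳ q m μ e ⟨
    coeff (q *ₚ binom m μ) e                ∎

  -- x^L − θ cancels from products when L ≥ 1 and θ is a unit: the e-th
  -- coefficient of p·(x^L − θ) is p_{e−L} − θ·p_e, which determines p_e
  -- from the coefficients of lower index.
  binom-cancelʳ : ∀ {L θ θ'} → 1 ≤ L → θ · θ' ≈ 1# → ∀ p q →
                  (p *ₚ binom L θ) ≈ₚ (q *ₚ binom L θ) → p ≈ₚ q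
  binom-cancelʳ {L} {θ} 1≤L θθ' p q eq = <-rec _ step
    where
    step : ∀ e → (∀ {i} → i < e → coeff p i ≈ coeff q i) → coeff p e ≈ coeff q e
    step e below = unit-cancelˡ (-‿unit θθ') (cancelˡ (sh L (coeff q) e) _ _ (begin
      sh L (coeff q) e ⊕ (- θ) · coeff p e   ≈⟨ +-congʳ shifted ⟨
      sh L (coeff p) e ⊕ (- θ) · coeff p e   ≈⟨ *ₚ-binomʳ p L θ e ⟨
      coeff (p *ₚ binom L θ) e               ≈⟨ eq e ⟩
      coeff (q *ₚ binom L θ) e               ≈⟨ *ₚ-binomʳ q L θ e ⟩
      sh L (coeff q) e ⊕ (- θ) · coeff q e   ∎))
      where
      shifted : sh L (coeff p) e ≈ sh L (coeff q) e
      shifted = sh-cong-below L e (λ i i+L≤e → below (ℕₚ.<-≤-trans (ℕₚ.m<m+n i 1≤L) i+L≤e))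

  vanish-by-recurrence : ∀ (φ : ℕ → F) {L M N c} → 1 ≤ M →
                         (∀ d → L ≤ d → φ d ≈ c · φ (M + d)) →
                         (∀ i → N ≤ i → φ i ≈ 0#) →
                         ∀ d → L ≤ d → φ d ≈ 0#
  vanish-by-recurrence φ {L} {M} {N} {c} 1≤M recurrence support d L≤d =
    vanish N d L≤d (ℕₚ.m≤n+m N d)
    where
    vanish : ∀ k d → L ≤ d → N ≤ d + k → φ d ≈ 0#
    vanish zero    d L≤d N≤d = support d (P.subst (N ≤_) (ℕₚ.+-identityʳ d) N≤d)
    vanish (suc k) d L≤d N≤d+k = begin
      φ d           ≈⟨ recurrence d L≤d ⟩
      c · φ (M + d) ≈⟨ *-congˡ (vanish k (M + d) (ℕₚ.≤-trans L≤d (ℕₚ.m≤n+m d M)) N≤) ⟩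
      c · 0#        ≈⟨ zeroʳ c ⟩
      0#            ∎
      where
      N≤ : N ≤ (M + d) + k
      N≤ = ℕₚ.≤-trans N≤d+k (P.subst (_≤ (M + d) + k) (P.sym (ℕₚ.+-suc d k))
                                      (ℕₚ.+-monoˡ-≤ k (ℕₚ.+-monoˡ-≤ d 1≤M)))

  module MulGk (L : ℕ) (θ : F) where

    -- mulGk B φ is the coefficient sequence of φ·g_B, computed through
    -- g_{B+1} = x^{LB} + θ·g_B
    mulGk : ℕ → (ℕ → F) → ℕ → F
    mulGk zero    φ e = 0#
    mulGk (suc B) φ e = sh (L * B) φ e ⊕ θ · mulGk B φ e

    sum-mono-scale : ∀ a (b : ℕ → F) (d : ℕ → ℕ) xs →
      sumₚ (List.map (λ i → mono (a · b i) (d i)) xs)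
        ≈ₚ scale a (sumₚ (List.map (λ i → mono (b i) (d i)) xs))
    sum-mono-scale a b d []       e = refl
    sum-mono-scale a b d (x ∷ xs) e = begin
      coeff (mono (a · b x) (d x) +ₚ S₁) e             ≈⟨ coeff-+ₚ (mono (a · b x) (d x)) S₁ e ⟩
      coeff (mono (a · b x) (d x)) e ⊕ coeff S₁ e
        ≈⟨ +-cong (trans (mono-scale a (b x) (d x) e) (coeff-scale a (mono (b x) (d x)) e))
                  (trans (sum-mono-scale a b d xs e) (coeff-scale a S₀ e)) ⟩
      a · coeff (mono (b x) (d x)) e ⊕ a · coeff S₀ e  ≈⟨ distribˡ a _ _ ⟨
      a · (coeff (mono (b x) (d x)) e ⊕ coeff S₀ e)    ≈⟨ *-congˡ (coeff-+ₚ (mono (b x) (d x)) S₀ e) ⟨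
      a · coeff (mono (b x) (d x) +ₚ S₀) e             ≈⟨ coeff-scale a (mono (b x) (d x) +ₚ S₀) e ⟨
      coeff (scale a (mono (b x) (d x) +ₚ S₀)) e       ∎
      where
      S₁ = sumₚ (List.map (λ i → mono (a · b i) (d i)) xs)
      S₀ = sumₚ (List.map (λ i → mono (b i) (d i)) xs)

    gk-suc : ∀ B → gk L (suc B) θ ≈ₚ (mono 1# (L * B) +ₚ scale θ (gk L B θ))
    gk-suc B e = begin
      coeff (mono 1# (L * B) +ₚ sumₚ (List.map T (applyUpTo suc B))) e
        ≡⟨ P.cong (λ xs → coeff (mono 1# (L * B) +ₚ sumₚ xs) e) reindex ⟩
      coeff (mono 1# (L * B) +ₚ sumₚ (List.map (λ i → T (suc i)) (upTo B))) e
        ≈⟨ coeff-+ₚ (mono 1# (L * B)) _ e ⟩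
      coeff (mono 1# (L * B)) e ⊕ coeff (sumₚ (List.map (λ i → T (suc i)) (upTo B))) e
        ≈⟨ +-congˡ (sum-mono-scale θ (pow θ) (λ i → L * (B ∸ i ∸ 1)) (upTo B) e) ⟩
      coeff (mono 1# (L * B)) e ⊕ coeff (scale θ (gk L B θ)) e
        ≈⟨ coeff-+ₚ (mono 1# (L * B)) (scale θ (gk L B θ)) e ⟨
      coeff (mono 1# (L * B) +ₚ scale θ (gk L B θ)) e
        ∎
      where
      T : ℕ → Poly
      T i = mono (pow θ i) (L * (suc B ∸ i ∸ 1))
      reindex : List.map T (applyUpTo suc B) ≡ List.map (λ i → T (suc i)) (upTo B)
      reindex = P.trans (Listₚ.map-applyUpTo suc T B) (P.sym (Listₚ.map-upTo (λ i → T (suc i)) B))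

    coeff-gk : ∀ B e → coeff (gk L B θ) e ≈ mulGk B δ e
    coeff-gk zero    e = refl
    coeff-gk (suc B) e = begin
      coeff (gk L (suc B) θ) e                                  ≈⟨ gk-suc B e ⟩
      coeff (mono 1# (L * B) +ₚ scale θ (gk L B θ)) e           ≈⟨ coeff-+ₚ (mono 1# (L * B)) (scale θ (gk L B θ)) e ⟩
      coeff (mono 1# (L * B)) e ⊕ coeff (scale θ (gk L B θ)) e
        ≈⟨ +-cong (reflexive (coeff-mono 1# (L * B) e)) (trans (coeff-scale θ (gk L B θ) e) (*-congˡ (coeff-gk B e))) ⟩
      sh (L * B) δ e ⊕ θ · mulGk B δ e                          ∎

    coeff-*ₚ-gk : ∀ B p e → coeff (p *ₚ gk L B θ) e ≈ mulGk B (coeff p) e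
    coeff-*ₚ-gk zero    p e = *ₚ-[]ʳ p e
    coeff-*ₚ-gk (suc B) p e = begin
      coeff (p *ₚ gk L (suc B) θ) e
        ≈⟨ *ₚ-congʳ (gk-suc B) p e ⟩
      coeff (p *ₚ (mono 1# (L * B) +ₚ scale θ (gk L B θ))) e
        ≈⟨ *ₚ-distribˡ p (mono 1# (L * B)) (scale θ (gk L B θ)) e ⟩
      coeff (p *ₚ mono 1# (L * B)) e ⊕ coeff (p *ₚ scale θ (gk L B θ)) e
        ≈⟨ +-cong (*ₚ-monoʳ p 1# (L * B) e) (*ₚ-scaleʳ p θ (gk L B θ) e) ⟩
      sh (L * B) (λ i → 1# · coeff p i) e ⊕ θ · coeff (p *ₚ gk L B θ) e
        ≈⟨ +-cong (sh-cong (λ i → *-identityˡ _) (L * B) e) (*-congˡ (coeff-*ₚ-gk B p e)) ⟩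
      sh (L * B) (coeff p) e ⊕ θ · mulGk B (coeff p) e
        ∎

    mulGk-cong : ∀ {φ ψ} → (∀ i → φ i ≈ ψ i) → ∀ B e → mulGk B φ e ≈ mulGk B ψ e
    mulGk-cong φ≈ψ zero    e = refl
    mulGk-cong φ≈ψ (suc B) e = +-cong (sh-cong φ≈ψ (L * B) e) (*-congˡ (mulGk-cong φ≈ψ B e))

    mulGk-+ : ∀ φ ψ B e → mulGk B (λ i → φ i ⊕ ψ i) e ≈ mulGk B φ e ⊕ mulGk B ψ e
    mulGk-+ φ ψ zero    e = sym (+-identityˡ 0#)
    mulGk-+ φ ψ (suc B) e = begin
      sh (L * B) (λ i → φ i ⊕ ψ i) e ⊕ θ · mulGk B (λ i → φ i ⊕ ψ i) e
        ≈⟨ +-cong (sh-+ φ ψ (L * B) e) (trans (*-congˡ (mulGk-+ φ ψ B e)) (distribˡ θ _ _)) ⟩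
      (sh (L * B) φ e ⊕ sh (L * B) ψ e) ⊕ (θ · mulGk B φ e ⊕ θ · mulGk B ψ e)
        ≈⟨ interchange _ _ _ _ ⟩
      (sh (L * B) φ e ⊕ θ · mulGk B φ e) ⊕ (sh (L * B) ψ e ⊕ θ · mulGk B ψ e)
        ∎

    mulGk-scale : ∀ a φ B e → mulGk B (λ i → a · φ i) e ≈ a · mulGk B φ e
    mulGk-scale a φ zero    e = sym (zeroʳ a)
    mulGk-scale a φ (suc B) e = begin
      sh (L * B) (λ i → a · φ i) e ⊕ θ · mulGk B (λ i → a · φ i) e
        ≈⟨ +-cong (sh-scale a φ (L * B) e) (trans (*-congˡ (mulGk-scale a φ B e)) (·-left-comm θ a _)) ⟩
      a · sh (L * B) φ e ⊕ a · (θ · mulGk B φ e)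
        ≈⟨ distribˡ a _ _ ⟨
      a · (sh (L * B) φ e ⊕ θ · mulGk B φ e)
        ∎

    mulGk-sh : ∀ φ B e → mulGk B (sh L φ) e ≈ sh L (mulGk B φ) e
    mulGk-sh φ zero    e = sym (sh-zero L e)
    mulGk-sh φ (suc B) e = begin
      sh (L * B) (sh L φ) e ⊕ θ · mulGk B (sh L φ) e
        ≈⟨ +-cong (reflexive (sh-comm φ (L * B) L e)) (*-congˡ (mulGk-sh φ B e)) ⟩
      sh L (sh (L * B) φ) e ⊕ θ · sh L (mulGk B φ) e
        ≈⟨ +-congˡ (sh-scale θ (mulGk B φ) L e) ⟨
      sh L (sh (L * B) φ) e ⊕ sh L (λ i → θ · mulGk B φ i) e
        ≈⟨ sh-+ _ _ L e ⟨
      sh L (λ i → sh (L * B) φ i ⊕ θ · mulGk B φ i) e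
        ∎

    mulGk-telescope : ∀ φ B e →
      sh L (mulGk B φ) e ⊕ (- θ) · mulGk B φ e ≈ sh (L * B) φ e ⊕ (- pow θ B) · φ e
    mulGk-telescope φ zero e = begin
      sh L (λ _ → 0#) e ⊕ (- θ) · 0#  ≈⟨ +-cong (sh-zero L e) (zeroʳ _) ⟩
      0# ⊕ 0#                        ≈⟨ +-identityˡ 0# ⟩
      0#                             ≈⟨ -‿inverseʳ (φ e) ⟨
      φ e ⊕ - φ e                    ≈⟨ +-congˡ (-1*x≈-x (φ e)) ⟨
      φ e ⊕ (- 1#) · φ e             ≡⟨ P.cong (λ d → sh d φ e ⊕ (- 1#) · φ e) (ℕₚ.*-zeroʳ L) ⟨
      sh (L * 0) φ e ⊕ (- 1#) · φ e  ∎
    mulGk-telescope φ (suc B) e = begin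
      sh L (λ i → sh (L * B) φ i ⊕ θ · mulGk B φ i) e ⊕ (- θ) · (sh (L * B) φ e ⊕ θ · mulGk B φ e)
        ≈⟨ +-congʳ (trans (sh-+ _ _ L e) (+-congˡ (sh-scale θ (mulGk B φ) L e))) ⟩
      (sh L (sh (L * B) φ) e ⊕ θ · sh L (mulGk B φ) e) ⊕ (- θ) · (sh (L * B) φ e ⊕ θ · mulGk B φ e)
        ≈⟨ telescope-step _ _ _ _ _ θ (pow θ B) (mulGk-telescope φ B e) ⟩
      sh L (sh (L * B) φ) e ⊕ (- (θ · pow θ B)) · φ e
        ≡⟨ P.cong (_⊕ (- (θ · pow θ B)) · φ e)
                  (P.trans (sh-sh φ L (L * B) e) (P.cong (λ d → sh d φ e) (P.sym (ℕₚ.*-suc L B)))) ⟩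
      sh (L * suc B) φ e ⊕ (- (θ · pow θ B)) · φ e
        ∎

    mulGk-binom : ∀ φ B e →
      mulGk B (λ i → sh L φ i ⊕ (- θ) · φ i) e ≈ sh (L * B) φ e ⊕ (- pow θ B) · φ e
    mulGk-binom φ B e = begin
      mulGk B (λ i → sh L φ i ⊕ (- θ) · φ i) e             ≈⟨ mulGk-+ _ _ B e ⟩
      mulGk B (sh L φ) e ⊕ mulGk B (λ i → (- θ) · φ i) e   ≈⟨ +-cong (mulGk-sh φ B e) (mulGk-scale (- θ) φ B e) ⟩
      sh L (mulGk B φ) e ⊕ (- θ) · mulGk B φ e             ≈⟨ mulGk-telescope φ B e ⟩
      sh (L * B) φ e ⊕ (- pow θ B) · φ e                   ∎

    module DegreeBelow (φ : ℕ → F) (deg-φ : ∀ d → L ≤ d → φ d ≈ 0#) where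
      mulGk-beyond : ∀ B e → L * B ≤ e → mulGk B φ e ≈ 0#
      mulGk-beyond zero    e _     = refl
      mulGk-beyond (suc B) e LB+L≤e = begin
        sh (L * B) φ e ⊕ θ · mulGk B φ e  ≈⟨ +-cong (reflexive (sh-≥ φ (L * B) e LB≤e)) (*-congˡ (mulGk-beyond B e LB≤e)) ⟩
        φ (e ∸ L * B) ⊕ θ · 0#            ≈⟨ +-cong (deg-φ _ L≤e∸LB) (zeroʳ θ) ⟩
        0# ⊕ 0#                           ≈⟨ +-identityˡ 0# ⟩
        0#                                ∎
        where
        L+LB≤e : L + L * B ≤ e
        L+LB≤e = P.subst (_≤ e) (ℕₚ.*-suc L B) LB+L≤e
        LB≤e : L * B ≤ e
        LB≤e = ℕₚ.≤-trans (ℕₚ.m≤n+m (L * B) L) L+LB≤e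
        L≤e∸LB : L ≤ e ∸ L * B
        L≤e∸LB = P.subst (_≤ e ∸ L * B) (ℕₚ.m+n∸n≡m L (L * B)) (ℕₚ.∸-monoˡ-≤ (L * B) L+LB≤e)

      mulGk-block : ∀ B j t → j < B → t < L → mulGk B φ (L * j + t) ≈ pow θ (B ∸ suc j) · φ t
      mulGk-block (suc B) j t j<1+B t<L with ℕₚ.m<1+n⇒m<n∨m≡n j<1+B
      ... | inj₂ P.refl = begin
        sh (L * j) φ (L * j + t) ⊕ θ · mulGk j φ (L * j + t)
          ≈⟨ +-cong (reflexive (sh-+ˡ φ (L * j) t)) (*-congˡ (mulGk-beyond j _ (ℕₚ.m≤m+n (L * j) t))) ⟩
        φ t ⊕ θ · 0#                   ≈⟨ trans (+-congˡ (zeroʳ θ)) (+-identityʳ _) ⟩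
        φ t                            ≈⟨ *-identityˡ _ ⟨
        1# · φ t                       ≡⟨ P.cong (λ d → pow θ d · φ t) (ℕₚ.n∸n≡0 j) ⟨
        pow θ (j ∸ j) · φ t            ∎
      ... | inj₁ j<B = begin
        sh (L * B) φ (L * j + t) ⊕ θ · mulGk B φ (L * j + t)
          ≈⟨ +-cong (reflexive (sh-< φ (L * B) _ (block-< L B j t j<B t<L))) (*-congˡ (mulGk-block B j t j<B t<L)) ⟩
        0# ⊕ θ · (pow θ (B ∸ suc j) · φ t)  ≈⟨ trans (+-identityˡ _) (sym (*-assoc _ _ _)) ⟩
        pow θ (suc (B ∸ suc j)) · φ t       ≡⟨ P.cong (λ d → pow θ d · φ t) (ℕₚ.+-∸-assoc 1 j<B) ⟨
        pow θ (B ∸ j) · φ t                 ∎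

      mulGk-reflected-block : ∀ B j t → j < B → t < L →
        mulGk B φ (L * (B ∸ suc j) + (L ∸ suc t)) ≈ pow θ j · φ (L ∸ suc t)
      mulGk-reflected-block B j t j<B t<L =
        trans (mulGk-block B (B ∸ suc j) (L ∸ suc t) (reflect-< B j j<B) (reflect-< L t t<L))
              (reflexive (P.cong (λ d → pow θ d · φ (L ∸ suc t)) (reflect-involutive B j j<B)))

  module Code (L B : ℕ) (θ θ' μ : F) (θ-unit : θ · θ' ≈ 1#) (μ≈θ^B : μ ≈ pow θ B)
              (1≤L : 1 ≤ L) (1≤B : 1 ≤ B) where
    open MulGk L θ

    instance
      L≢0 : NonZero L
      L≢0 = ℕ.>-nonZero 1≤L

    h : Poly
    h = binom L θ

    gk-isGenPoly : IsGenPolyFor (L * B) μ h (gk L B θ)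
    gk-isGenPoly e = begin
      coeff (gk L B θ *ₚ h) e                                  ≈⟨ *ₚ-binomʳ (gk L B θ) L θ e ⟩
      sh L (coeff (gk L B θ)) e ⊕ (- θ) · coeff (gk L B θ) e   ≈⟨ +-cong (sh-cong (coeff-gk B) L e) (*-congˡ (coeff-gk B e)) ⟩
      sh L (mulGk B δ) e ⊕ (- θ) · mulGk B δ e                 ≈⟨ mulGk-telescope δ B e ⟩
      sh (L * B) δ e ⊕ (- pow θ B) · δ e                       ≈⟨ +-congˡ (*-congʳ (-‿cong μ≈θ^B)) ⟨
      sh (L * B) δ e ⊕ (- μ) · δ e                             ≈⟨ coeff-binom (L * B) μ e ⟨
      coeff (binom (L * B) μ) e                                ∎

    -- it is the only one, since x^L − θ cancels
    genPoly-unique : ∀ g → IsGenPolyFor (L * B) μ h g → g ≈ₚ gk L B θ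
    genPoly-unique g g-gen = binom-cancelʳ 1≤L θ-unit g (gk L B θ) (λ e → trans (g-gen e) (sym (gk-isGenPoly e)))

    genPoly-iff : ∀ g → IsGenPolyFor (L * B) μ h g ⇔ (g ≈ₚ gk L B θ)
    genPoly-iff g = mk⇔ (genPoly-unique g)
                        (λ g≈gk e → trans (*ₚ-binom-congˡ g (gk L B θ) L θ g≈gk e) (gk-isGenPoly e))

    IsMultiple : Vec F (L * B) → (ℕ → F) → Set ℓ
    IsMultiple v φ = ∀ e → coeff (vecPoly v) e ≈ mulGk B φ e

    -- a codeword v ≡ f·g (mod x^{LB} − μ) is (f + t·(x^L − θ))·g_B
    code⇒multiple : ∀ v → InCodeWithParityCheck (L * B) μ h v → ∃ λ φ → IsMultiple v (coeff φ)
    code⇒multiple v (g , g-gen , f , t , v≡fg) = f +ₚ (t *ₚ h) , multiple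
      where
      t̂ = coeff t
      multiple-of-g : ∀ e → coeff (f *ₚ g) e ≈ mulGk B (coeff f) e
      multiple-of-g e = trans (*ₚ-congʳ (genPoly-unique g g-gen) f e) (coeff-*ₚ-gk B f e)
      multiple-of-binom : ∀ e → coeff (t *ₚ binom (L * B) μ) e ≈ mulGk B (coeff (t *ₚ h)) e
      multiple-of-binom e = begin
        coeff (t *ₚ binom (L * B) μ) e             ≈⟨ *ₚ-binomʳ t (L * B) μ e ⟩
        sh (L * B) t̂ e ⊕ (- μ) · t̂ e               ≈⟨ +-congˡ (*-congʳ (-‿cong μ≈θ^B)) ⟩
        sh (L * B) t̂ e ⊕ (- pow θ B) · t̂ e         ≈⟨ mulGk-binom t̂ B e ⟨
        mulGk B (λ i → sh L t̂ i ⊕ (- θ) · t̂ i) e   ≈⟨ mulGk-cong (λ i → *ₚ-binomʳ t L θ i) B e ⟨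
        mulGk B (coeff (t *ₚ h)) e                 ∎
      multiple : IsMultiple v (coeff (f +ₚ (t *ₚ h)))
      multiple e = begin
        coeff (vecPoly v) e
          ≈⟨ move-right (trans (+-congˡ (sym (coeff--ₚ (f *ₚ g) e)))
                               (trans (sym (coeff-+ₚ (vecPoly v) (-ₚ (f *ₚ g)) e)) (v≡fg e))) ⟩
        coeff (f *ₚ g) e ⊕ coeff (t *ₚ binom (L * B) μ) e
          ≈⟨ +-cong (multiple-of-g e) (multiple-of-binom e) ⟩
        mulGk B (coeff f) e ⊕ mulGk B (coeff (t *ₚ h)) e
          ≈⟨ mulGk-+ (coeff f) (coeff (t *ₚ h)) B e ⟨
        mulGk B (λ i → coeff f i ⊕ coeff (t *ₚ h) i) e
          ≈⟨ mulGk-cong (coeff-+ₚ f (t *ₚ h)) B e ⟨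
        mulGk B (coeff (f +ₚ (t *ₚ h))) e
          ∎

    -- a multiple φ·g_B of degree < LB has deg φ < L: as v(x^L − θ) has
    -- degree < LB + L, φ_d ≈ θ^B·φ_{LB+d} for d ≥ L
    multiple-degree : ∀ v φ → IsMultiple v (coeff φ) → ∀ d → L ≤ d → coeff φ d ≈ 0#
    multiple-degree v φ v=φg =
      vanish-by-recurrence (coeff φ) {L} {L * B} {length φ} {pow θ B} (ℕₚ.*-mono-≤ 1≤L 1≤B) recurrence
                           (λ i len≤i → reflexive (coeff-beyond φ i len≤i))
      where
      v̂ = coeff (vecPoly v)
      recurrence : ∀ d → L ≤ d → coeff φ d ≈ pow θ B · coeff φ (L * B + d)
      recurrence d L≤d = difference-zero (begin
        coeff φ d ⊕ (- pow θ B) · coeff φ e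
          ≡⟨ P.cong (_⊕ (- pow θ B) · coeff φ e) (sh-+ˡ (coeff φ) (L * B) d) ⟨
        sh (L * B) (coeff φ) e ⊕ (- pow θ B) · coeff φ e
          ≈⟨ mulGk-telescope (coeff φ) B e ⟨
        sh L (mulGk B (coeff φ)) e ⊕ (- θ) · mulGk B (coeff φ) e
          ≈⟨ +-cong (sh-cong v=φg L e) (*-congˡ (v=φg e)) ⟨
        sh L v̂ e ⊕ (- θ) · v̂ e
          ≈⟨ +-cong (reflexive (P.trans (sh-≥ v̂ L e L≤e) (coeff-vecPoly-beyond v (e ∸ L) LB≤e∸L)))
                    (*-congˡ (reflexive (coeff-vecPoly-beyond v e (ℕₚ.m≤m+n (L * B) d)))) ⟩
        0# ⊕ (- θ) · 0#
          ≈⟨ trans (+-identityˡ _) (zeroʳ (- θ)) ⟩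
        0#
          ∎)
        where
        e = L * B + d
        L≤e : L ≤ e
        L≤e = ℕₚ.≤-trans L≤d (ℕₚ.m≤n+m d (L * B))
        LB≤e∸L : L * B ≤ e ∸ L
        LB≤e∸L = P.subst (L * B ≤_) (P.sym (ℕₚ.+-∸-assoc (L * B) L≤d)) (ℕₚ.m≤m+n (L * B) (d ∸ L))

    multiple⇒blocks : ∀ v φ → (∀ d → L ≤ d → φ d ≈ 0#) → IsMultiple v φ →
                      ∃ λ a → IsBlockVector L B v a θ
    multiple⇒blocks v φ deg-φ v=φg = a , blocks
      where
      open DegreeBelow φ deg-φ
      a : Vec F L
      a = Vec.tabulate (λ t → φ (L ∸ suc (toℕ t)))
      blocks : IsBlockVector L B v a θ
      blocks j t j<B = begin
        at v (j * L + toℕ t)                                 ≡⟨ coeff-vecPoly-block L B v j (toℕ t) j<B t<L ⟨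
        coeff (vecPoly v) (L * (B ∸ suc j) + (L ∸ suc (toℕ t))) ≈⟨ v=φg _ ⟩
        mulGk B φ (L * (B ∸ suc j) + (L ∸ suc (toℕ t)))      ≈⟨ mulGk-reflected-block B j (toℕ t) j<B t<L ⟩
        pow θ j · φ (L ∸ suc (toℕ t))                        ≈⟨ *-comm _ _ ⟩
        φ (L ∸ suc (toℕ t)) · pow θ j                        ≡⟨ P.cong (_· pow θ j) (Vecₚ.lookup∘tabulate _ t) ⟨
        Vec.lookup a t · pow θ j                             ∎
        where t<L = Finₚ.toℕ<n t

    blocks⇒multiple : ∀ v a → IsBlockVector L B v a θ → IsMultiple v (coeff (vecPoly a))
    blocks⇒multiple v a blocks = multiple
      where
      φ = coeff (vecPoly a)
      open DegreeBelow φ (λ d L≤d → reflexive (coeff-vecPoly-beyond a d L≤d))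
      in-block : ∀ j (t : Fin L) → j < B →
                 coeff (vecPoly v) (L * (B ∸ suc j) + (L ∸ suc (toℕ t))) ≈ mulGk B φ (L * (B ∸ suc j) + (L ∸ suc (toℕ t)))
      in-block j t j<B = begin
        coeff (vecPoly v) (L * (B ∸ suc j) + (L ∸ suc (toℕ t))) ≡⟨ coeff-vecPoly-block L B v j (toℕ t) j<B t<L ⟩
        at v (j * L + toℕ t)                                 ≈⟨ blocks j t j<B ⟩
        Vec.lookup a t · pow θ j                             ≈⟨ *-comm _ _ ⟩
        pow θ j · Vec.lookup a t                             ≡⟨ P.cong (pow θ j ·_) (P.trans (lookup-at a t) (P.sym (coeff-vecPoly a (toℕ t) t<L))) ⟩
        pow θ j · φ (L ∸ suc (toℕ t))                        ≈⟨ mulGk-reflected-block B j (toℕ t) j<B t<L ⟨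
        mulGk B φ (L * (B ∸ suc j) + (L ∸ suc (toℕ t)))      ∎
        where t<L = Finₚ.toℕ<n t
      multiple : IsMultiple v φ
      multiple e with e ℕ.<? L * B
      ... | no e≮LB = trans (reflexive (coeff-vecPoly-beyond v e (ℕₚ.≮⇒≥ e≮LB))) (sym (mulGk-beyond B e (ℕₚ.≮⇒≥ e≮LB)))
      ... | yes e<LB with reflected-block-decomposition L B e e<LB
      ...   | j , t , j<B , P.refl = in-block j t j<B

    multiple⇒code : ∀ v f → IsMultiple v (coeff f) → InCodeWithParityCheck (L * B) μ h v
    multiple⇒code v f v=fg = gk L B θ , gk-isGenPoly , f , [] , λ e → begin
      coeff (vecPoly v -ₚ (f *ₚ gk L B θ)) e               ≈⟨ coeff-+ₚ (vecPoly v) (-ₚ (f *ₚ gk L B θ)) e ⟩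
      coeff (vecPoly v) e ⊕ coeff (-ₚ (f *ₚ gk L B θ)) e   ≈⟨ +-congˡ (coeff--ₚ (f *ₚ gk L B θ) e) ⟩
      coeff (vecPoly v) e ⊕ - coeff (f *ₚ gk L B θ) e      ≈⟨ +-cong (v=fg e) (-‿cong (coeff-*ₚ-gk B f e)) ⟩
      mulGk B (coeff f) e ⊕ - mulGk B (coeff f) e          ≈⟨ -‿inverseʳ _ ⟩
      0#                                                   ∎

    code-iff : ∀ v → InCodeWithParityCheck (L * B) μ h v ⇔ ∃ (λ a → IsBlockVector L B v a θ)
    code-iff v = mk⇔
      (λ v∈C → let φ , v=φg = code⇒multiple v v∈C
               in multiple⇒blocks v (coeff φ) (multiple-degree v φ v=φg) v=φg)
      (λ (a , blocks) → multiple⇒code v (vecPoly a) (blocks⇒multiple v a blocks))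

theorem4p2 : ∀ {c ℓ'} (R : CommutativeRing c ℓ') →
    let open CommutativeRing R using (Carrier)
        open FieldDefs R
    in IsField →
    (q l s : ℕ) → HasSize q →
    Prime l → Coprime l q →
    (l ^ s) ∣ (q ∸ 1) → ¬ ((l ^ suc s) ∣ (q ∸ 1)) →
    1 ≤ s → (l ≡ 2 → s ≢ 1) →
    (μs : Carrier) → IsPrimitiveRoot (l ^ s) μs →
    (n k : ℕ) → 1 ≤ n → 1 ≤ k → k ≤ s →
    let r = n ⊓ (s ∸ k)
        μ = λ j → pow μs (l ^ (s ∸ j))
        m = l ^ n
        L = l ^ (n ∸ r)
        B = l ^ r
        h = binom L (μ (k + r))
    in (∀ g → IsGenPolyFor m (μ k) h g ⇔ (g ≈ₚ gk L B (μ (k + r))))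
       × (∀ (v : Vec Carrier m) →
            InCodeWithParityCheck m (μ k) h v
              ⇔ ∃ (λ (a : Vec Carrier L) → IsBlockVector L B v a (μ (k + r))))
theorem4p2 R _ _ l s _ l-prime _ _ _ _ _ μs μs-primitive n k _ _ _ =
  P.subst (λ m → (∀ g → IsGenPolyFor m μk h g ⇔ (g ≈ₚ gk L B θ))
               × (∀ (v : Vec F m) → InCodeWithParityCheck m μk h v ⇔ ∃ (λ a → IsBlockVector L B v a θ)))
          (P.sym length≡LB)
          (genPoly-iff , code-iff)
  where
  open CommutativeRing R using (_≈_; 1#; trans; sym; reflexive) renaming (Carrier to F; _*_ to _·_)
  open FieldDefs R
  open Constacyclic R using (pow-+; pow-*)

  instance
    l≢0 : NonZero l
    l≢0 = prime⇒nonZero l-prime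

  r = n ⊓ (s ∸ k)
  L = l ^ (n ∸ r)
  B = l ^ r
  N = l ^ (s ∸ (k + r))
  θ = pow μs N
  θ' = pow μs (l ^ s ∸ N)
  μk = pow μs (l ^ (s ∸ k))

  length≡LB : l ^ n ≡ L * B
  length≡LB = P.trans (P.cong (l ^_) (P.sym (ℕₚ.m∸n+n≡m (ℕₚ.m⊓n≤m n (s ∸ k)))))
                      (ℕₚ.^-distribˡ-+-* l (n ∸ r) r)

  -- ℓ^{s−k} = ℓ^{s−k−r}·ℓ^r
  μk≈θ^B : μk ≈ pow θ B
  μk≈θ^B = trans (reflexive (P.cong (pow μs) exponent)) (pow-* μs N B)
    where
    exponent : l ^ (s ∸ k) ≡ N * B
    exponent = P.trans (P.cong (l ^_) (P.trans (P.sym (ℕₚ.m∸n+n≡m (ℕₚ.m⊓n≤n n (s ∸ k))))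
                                               (P.cong (_+ r) (ℕₚ.∸-+-assoc s k r))))
                       (ℕₚ.^-distribˡ-+-* l (s ∸ (k + r)) r)

  -- θ·μ_s^{ℓ^s − N} = μ_s^{ℓ^s} = 1
  θ-unit : θ · θ' ≈ 1#
  θ-unit = trans (sym (pow-+ μs N (l ^ s ∸ N)))
                 (trans (reflexive (P.cong (pow μs) (ℕₚ.m+[n∸m]≡n N≤ℓ^s))) (proj₁ μs-primitive))
    where
    N≤ℓ^s : N ≤ l ^ s
    N≤ℓ^s = ℕₚ.^-monoʳ-≤ l (ℕₚ.m∸n≤m s (k + r))

  open Constacyclic.Code R L B θ θ' μk θ-unit μk≈θ^B (ℕₚ.m^n>0 l (n ∸ r)) (ℕₚ.m^n>0 l r)
    using (h; genPoly-iff; code-iff)
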